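{- For $n,k\ge0$ let $f(n,k)$ be the number of $k$-element subsets $\{p_1<p_2<\cdots<p_k\}\subseteq\{1,\ldots,n\}$ with $p_1+\cdots+p_j\le p_{j+1}$ for all $1\le j\le k-1$. Let $a(m,p)$ be the number of non-squashing partitions of $m$ into exactly $p$ parts (with $a(0,0)=1$), and define $\gamma(i)=i$ for $1\le i\le 3$ and $\gamma(i)=3\cdot 2^{i-3}$ for $i\ge 3$. Then $f(n,0)=1$ for all $n$, and for $n\ge1$, $k\ge1$, $$f(n,k)=\sum_{p=0}^{\min\{k-1,\,n-\gamma(k)\}}\ \sum_{m=p}^{n-\gamma(k)}\bigl(n-\gamma(k)+1-m\bigr)\,a(m,p),$$ where the sum is empty (equal to $0$) when $n<\gamma(k)$.
   Context: A partition $m=p_1+p_2+\cdots+p_k$ with parts written in nondecreasing order $1\le p_1\le\cdots\le p_k$ is called non-squashing if $p_1+\cdots+p_j\le p_{j+1}$ for all $1\le j\le k-1$. The empty partition of $0$ is the unique partition with $0$ parts. -}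

module Defs where

open import Data.Nat using (ℕ; zero; suc; _+_; _*_; _∸_; _^_; _≤_; _≤?_)
open import Data.List using (List; []; _∷_; [_]; _++_; map; length; filter; upTo)
open import Data.Nat.ListAction using (sum)
open import Data.List.Relation.Unary.Linked using (Linked; linked?)
open import Data.Product using (_×_)
open import Data.Unit using (⊤; tt)
open import Relation.Nullary using (Dec; yes; no)
open import Relation.Nullary.Decidable using (_×-dec_)
open import Relation.Binary.PropositionalEquality using (_≡_)
open import Data.Nat using (_≟_)

-- Non-squashing condition on a list p₁ ∷ p₂ ∷ … : for every j ≥ 1,
-- p₁ + ⋯ + p_j ≤ p_{j+1}.  'acc' is the running sum of the parts already
-- seen (the condition at the first part, 0 ≤ p₁, is trivially true).
NonSquashingFrom : ℕ → List ℕ → Set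
NonSquashingFrom acc []       = ⊤
NonSquashingFrom acc (x ∷ xs) = acc ≤ x × NonSquashingFrom (acc + x) xs

NonSquashing : List ℕ → Set
NonSquashing = NonSquashingFrom 0

nonSquashingFrom? : ∀ acc xs → Dec (NonSquashingFrom acc xs)
nonSquashingFrom? acc []       = yes tt
nonSquashingFrom? acc (x ∷ xs) = (acc ≤? x) ×-dec nonSquashingFrom? (acc + x) xs

nonSquashing? : ∀ xs → Dec (NonSquashing xs)
nonSquashing? = nonSquashingFrom? 0

sublists : List ℕ → List (List ℕ)
sublists []       = [ [] ]
sublists (x ∷ xs) = sublists xs ++ map (x ∷_) (sublists xs)

oneTo : ℕ → List ℕ
oneTo n = map suc (upTo n)

-- The k-element subsets {p₁ < ⋯ < p_k} of {1,…,n} are exactly the sublists of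
-- length k of [1,…,n] (each listed once, in increasing order).
-- f(n,k) = number of those satisfying the non-squashing condition.
f : ℕ → ℕ → ℕ
f n k = length (filter (λ xs → (length xs ≟ k) ×-dec nonSquashing? xs) (sublists (oneTo n)))

listsOfLength : ℕ → List ℕ → List (List ℕ)
listsOfLength zero    cs = [ [] ]
listsOfLength (suc p) cs = Data.List.concatMap (λ c → map (c ∷_) (listsOfLength p cs)) cs

-- a(m,p) = number of non-squashing partitions of m into exactly p parts:
-- nondecreasing lists of p positive integers (each part is ≤ m) summing to m
-- that are non-squashing.  a(0,0) = 1 (the empty list).
a : ℕ → ℕ → ℕ
a m p = length (filter (λ xs → linked? _≤?_ xs ×-dec (sum xs ≟ m) ×-dec nonSquashing? xs)
                       (listsOfLength p (oneTo m)))

-- γ(i) = i for 1 ≤ i ≤ 3, γ(i) = 3·2^(i-3) for i ≥ 3.  (γ(0) is never used; set to 0.)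
γ : ℕ → ℕ
γ 0 = 0
γ 1 = 1
γ 2 = 2
γ (suc (suc (suc i))) = 3 * 2 ^ i

-- Σ_{i=lo}^{hi} g(i)  (empty, = 0, when hi < lo)
sumFromTo : ℕ → ℕ → (ℕ → ℕ) → ℕ
sumFromTo lo hi g = sum (map (λ i → g (lo + i)) (upTo (suc hi ∸ lo)))

-- Subtracting γ(i) from the i-th element turns a subset p₁ < p₂ < ⋯ < p_k of
-- {1, …, n} counted by f(n,k) into a list 0 ≤ q₁ ≤ q₂ ≤ ⋯ ≤ q_k ≤ n − γ(k) that is
-- non-squashing with zero parts allowed: γ(1) + ⋯ + γ(j) = γ(j+1) for j ≥ 2, and the
-- strict inequality p₁ < p₂ compensates for γ(1) = γ(2) − 1.  Sorting these lists q
-- by the total m of q₁, …, q_{k−1} gives the formula: q_k ranges over [m, n − γ(k)],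
-- and dropping the leading zeros of q₁, …, q_{k−1} leaves a non-squashing partition
-- of m into p ≤ k − 1 parts.

module Submission where

open import Defs
open import Data.Bool using (true; false; if_then_else_)
open import Data.List using (List; []; _∷_; _++_; _∷ʳ_; map; length; filter; applyUpTo; upTo; concatMap)
open import Data.List.Properties using (map-++; map-∘; map-cong; map-applyUpTo; applyUpTo-∷ʳ)
open import Data.List.Relation.Unary.Linked using (Linked; []; [-]; _∷_; linked?)
open import Data.Nat using (ℕ; zero; suc; _+_; _*_; _∸_; _≤_; _<_; _⊓_; z≤n; s≤s; _^_; _≤?_; _<?_; _≟_)
open import Data.Nat.ListAction using (sum)
open import Data.Nat.ListAction.Properties using (sum-++)
open import Data.Nat.Properties
open import Data.Product using (_×_; _,_; proj₂)
open import Data.Unit using (tt)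
open import Function using (_∘_)
open import Relation.Binary.PropositionalEquality
  using (_≡_; refl; sym; trans; cong; cong₂; subst; module ≡-Reasoning)
open import Relation.Nullary using (Dec; yes; no; does; _×-dec_; contradiction)
open import Data.Nat.Tactic.RingSolver using (solve-∀)
open import Algebra.Properties.CommutativeSemigroup +-commutativeSemigroup
  using () renaming (interchange to +-interchange)
open import Algebra.Properties.CommutativeSemigroup *-commutativeSemigroup
  using () renaming (x∙yz≈y∙xz to x*[y*z]≡y*[x*z])

∑< : ℕ → (ℕ → ℕ) → ℕ
∑< c g = sum (applyUpTo g c)

infix 5 ∑<
syntax ∑< c (λ i → e) = ∑[ i < c ] e

∑-cong : ∀ c {g h : ℕ → ℕ} → (∀ i → i < c → g i ≡ h i) → ∑< c g ≡ ∑< c h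
∑-cong zero    eq = refl
∑-cong (suc c) eq = cong₂ _+_ (eq 0 (s≤s z≤n)) (∑-cong c (λ i i<c → eq (suc i) (s≤s i<c)))

∑≡0 : ∀ c {g : ℕ → ℕ} → (∀ i → i < c → g i ≡ 0) → ∑< c g ≡ 0
∑≡0 zero    eq = refl
∑≡0 (suc c) eq = cong₂ _+_ (eq 0 (s≤s z≤n)) (∑≡0 c (λ i i<c → eq (suc i) (s≤s i<c)))

∑-distrib-+ : ∀ c (g h : ℕ → ℕ) → ∑[ i < c ] (g i + h i) ≡ ∑< c g + ∑< c h
∑-distrib-+ zero    g h = refl
∑-distrib-+ (suc c) g h =
  trans (cong (g 0 + h 0 +_) (∑-distrib-+ c (g ∘ suc) (h ∘ suc))) (+-interchange (g 0) (h 0) _ _)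

*-distribˡ-∑ : ∀ c k (g : ℕ → ℕ) → k * ∑< c g ≡ ∑[ i < c ] (k * g i)
*-distribˡ-∑ zero    k g = *-zeroʳ k
*-distribˡ-∑ (suc c) k g = trans (*-distribˡ-+ k (g 0) _) (cong (k * g 0 +_) (*-distribˡ-∑ c k (g ∘ suc)))

*-distribʳ-∑ : ∀ c k (g : ℕ → ℕ) → ∑< c g * k ≡ ∑[ i < c ] g i * k
*-distribʳ-∑ zero    k g = refl
*-distribʳ-∑ (suc c) k g = trans (*-distribʳ-+ k (g 0) _) (cong (g 0 * k +_) (*-distribʳ-∑ c k (g ∘ suc)))

∑-comm : ∀ a b (g : ℕ → ℕ → ℕ) → ∑[ i < a ] ∑[ j < b ] g i j ≡ ∑[ j < b ] ∑[ i < a ] g i j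
∑-comm zero    b g = sym (∑≡0 b (λ _ _ → refl))
∑-comm (suc a) b g = trans (cong (∑< b (g 0) +_) (∑-comm a b (g ∘ suc)))
                           (sym (∑-distrib-+ b (g 0) (λ j → ∑[ i < a ] g (suc i) j)))

∑-+ : ∀ a b (g : ℕ → ℕ) → ∑< (a + b) g ≡ ∑< a g + (∑[ i < b ] g (a + i))
∑-+ zero    b g = refl
∑-+ (suc a) b g = trans (cong (g 0 +_) (∑-+ a b (g ∘ suc))) (sym (+-assoc (g 0) _ _))

∑-suc : ∀ c (g : ℕ → ℕ) → ∑< (suc c) g ≡ ∑< c g + g c
∑-suc c g = begin
  sum (applyUpTo g (suc c))               ≡⟨ cong sum (applyUpTo-∷ʳ g c) ⟨
  sum (applyUpTo g c ∷ʳ g c)              ≡⟨ sum-++ (applyUpTo g c) (g c ∷ []) ⟩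
  ∑< c g + (g c + 0)                      ≡⟨ cong (∑< c g +_) (+-identityʳ (g c)) ⟩
  ∑< c g + g c                            ∎
  where open ≡-Reasoning

∑-const : ∀ c k → ∑[ _ < c ] k ≡ c * k
∑-const zero    k = refl
∑-const (suc c) k = cong (k +_) (∑-const c k)

∑-truncate : ∀ {c c'} (g : ℕ → ℕ) → c ≤ c' → (∀ i → c ≤ i → i < c' → g i ≡ 0) → ∑< c' g ≡ ∑< c g
∑-truncate {c} {c'} g c≤c' vanish = begin
  ∑< c' g                                 ≡⟨ cong (λ t → ∑< t g) (m+[n∸m]≡n c≤c') ⟨
  ∑< (c + (c' ∸ c)) g                     ≡⟨ ∑-+ c (c' ∸ c) g ⟩
  ∑< c g + (∑[ i < c' ∸ c ] g (c + i))    ≡⟨ cong (∑< c g +_) (∑≡0 (c' ∸ c) tail≡0) ⟩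
  ∑< c g + 0                              ≡⟨ +-identityʳ _ ⟩
  ∑< c g                                  ∎
  where
  open ≡-Reasoning
  tail≡0 : ∀ i → i < c' ∸ c → g (c + i) ≡ 0
  tail≡0 i i< = vanish (c + i) (m≤m+n c i) (subst (c + i <_) (m+[n∸m]≡n c≤c') (+-monoʳ-< c i<))

∑-dropLeadingZeros : ∀ p c (g : ℕ → ℕ) → (∀ i → i < p → g i ≡ 0) → ∑[ i < c ∸ p ] g (p + i) ≡ ∑< c g
∑-dropLeadingZeros p c g vanish with p ≤? c
... | yes p≤c = sym (begin
  ∑< c g                                  ≡⟨ cong (λ t → ∑< t g) (m+[n∸m]≡n p≤c) ⟨
  ∑< (p + (c ∸ p)) g                      ≡⟨ ∑-+ p (c ∸ p) g ⟩
  ∑< p g + (∑[ i < c ∸ p ] g (p + i))     ≡⟨ cong (_+ (∑[ i < c ∸ p ] g (p + i))) (∑≡0 p vanish) ⟩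
  ∑[ i < c ∸ p ] g (p + i)                ∎)
  where open ≡-Reasoning
... | no p≰c = trans (cong (λ t → ∑[ i < t ] g (p + i)) (m≤n⇒m∸n≡0 (<⇒≤ c<p)))
                     (sym (∑≡0 c (λ i i<c → vanish i (<-trans i<c c<p))))
  where
  c<p : c < p
  c<p = ≰⇒> p≰c

sumFromTo≡∑ : ∀ lo hi g → sumFromTo lo hi g ≡ ∑[ i < suc hi ∸ lo ] g (lo + i)
sumFromTo≡∑ lo hi g = cong sum (map-applyUpTo (λ i → i) (λ i → g (lo + i)) (suc hi ∸ lo))

[_≤_] : ℕ → ℕ → ℕ
[ zero  ≤ x     ] = 1
[ suc a ≤ zero  ] = 0
[ suc a ≤ suc x ] = [ a ≤ x ]

[_≡_] : ℕ → ℕ → ℕ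
[ zero  ≡ zero  ] = 1
[ zero  ≡ suc z ] = 0
[ suc a ≡ zero  ] = 0
[ suc a ≡ suc z ] = [ a ≡ z ]

[≤]-yes : ∀ {a x} → a ≤ x → [ a ≤ x ] ≡ 1
[≤]-yes z≤n       = refl
[≤]-yes (s≤s a≤x) = [≤]-yes a≤x

[≤]-no : ∀ {a x} → x < a → [ a ≤ x ] ≡ 0
[≤]-no {suc a} {zero}  _         = refl
[≤]-no {suc a} {suc x} (s≤s x<a) = [≤]-no x<a

[≡]-no : ∀ {a z} → z < a → [ a ≡ z ] ≡ 0
[≡]-no {suc a} {zero}  _         = refl
[≡]-no {suc a} {suc z} (s≤s z<a) = [≡]-no z<a

[≤]-suc : ∀ a x → [ a ≤ x ] ≡ [ suc a ≤ x ] + [ a ≡ x ]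
[≤]-suc zero    zero    = refl
[≤]-suc zero    (suc x) = refl
[≤]-suc (suc a) zero    = refl
[≤]-suc (suc a) (suc x) = [≤]-suc a x

[≤]*-cong : ∀ a x {s t} → (a ≤ x → s ≡ t) → [ a ≤ x ] * s ≡ [ a ≤ x ] * t
[≤]*-cong a x eq with a ≤? x
... | yes a≤x = cong ([ a ≤ x ] *_) (eq a≤x)
... | no  a≰x = trans (cong (_* _) [a≤x]≡0) (sym (cong (_* _) [a≤x]≡0))
  where
  [a≤x]≡0 : [ a ≤ x ] ≡ 0
  [a≤x]≡0 = [≤]-no (≰⇒> a≰x)

[≤]*-vanish : ∀ a x {t} → (a ≤ x → t ≡ 0) → [ a ≤ x ] * t ≡ 0
[≤]*-vanish a x t≡0 = trans ([≤]*-cong a x t≡0) (*-zeroʳ [ a ≤ x ])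

∑-[≡] : ∀ a b (w : ℕ → ℕ) → a < b → ∑[ z < b ] [ a ≡ z ] * w z ≡ w a
∑-[≡] zero    (suc b) w _         =
  trans (cong₂ _+_ (+-identityʳ (w 0)) (∑≡0 b (λ _ _ → refl))) (+-identityʳ (w 0))
∑-[≡] (suc a) (suc b) w (s≤s a<b) = ∑-[≡] a b (w ∘ suc) a<b

∑-[≤]-shift : ∀ d a c (g : ℕ → ℕ) → ∑[ y < c ] [ d + a ≤ y ] * g y ≡ ∑[ i < c ∸ d ] [ a ≤ i ] * g (d + i)
∑-[≤]-shift zero    a c       g = refl
∑-[≤]-shift (suc d) a zero    g = refl
∑-[≤]-shift (suc d) a (suc c) g = ∑-[≤]-shift d a c (g ∘ suc)

𝟙 : ∀ {p} {P : Set p} → Dec P → ℕ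
𝟙 P? = if does P? then 1 else 0

𝟙-×-dec : ∀ {p q} {P : Set p} {Q : Set q} (P? : Dec P) (Q? : Dec Q) → 𝟙 (P? ×-dec Q?) ≡ 𝟙 P? * 𝟙 Q?
𝟙-×-dec (yes _) Q? = sym (+-identityʳ (𝟙 Q?))
𝟙-×-dec (no  _) Q? = refl

𝟙-×-dec-redundant : ∀ {p q} {P : Set p} {Q : Set q} (P? : Dec P) (Q? : Dec Q) →
                    (Q → P) → 𝟙 (P? ×-dec Q?) ≡ 𝟙 Q?
𝟙-×-dec-redundant (yes _) Q?      Q⇒P = refl
𝟙-×-dec-redundant (no ¬p) (yes q) Q⇒P = contradiction (Q⇒P q) ¬p
𝟙-×-dec-redundant (no _)  (no _)  Q⇒P = refl

𝟙-×-dec-middle : ∀ {p q r} {P : Set p} {Q : Set q} {R : Set r} (P? : Dec P) (Q? : Dec Q) (R? : Dec R) →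
                 𝟙 (P? ×-dec (Q? ×-dec R?)) ≡ 𝟙 Q? * 𝟙 (P? ×-dec R?)
𝟙-×-dec-middle P? Q? R? = begin
  𝟙 (P? ×-dec (Q? ×-dec R?))   ≡⟨ trans (𝟙-×-dec P? (Q? ×-dec R?)) (cong (𝟙 P? *_) (𝟙-×-dec Q? R?)) ⟩
  𝟙 P? * (𝟙 Q? * 𝟙 R?)         ≡⟨ x*[y*z]≡y*[x*z] (𝟙 P?) (𝟙 Q?) (𝟙 R?) ⟩
  𝟙 Q? * (𝟙 P? * 𝟙 R?)         ≡⟨ cong (𝟙 Q? *_) (𝟙-×-dec P? R?) ⟨
  𝟙 Q? * 𝟙 (P? ×-dec R?)       ∎
  where open ≡-Reasoning

𝟙-≤? : ∀ a x → 𝟙 (a ≤? x) ≡ [ a ≤ x ]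
𝟙-≤? a x = 𝟙-[≤] (a ≤? x)
  where
  𝟙-[≤] : (a≤?x : Dec (a ≤ x)) → 𝟙 a≤?x ≡ [ a ≤ x ]
  𝟙-[≤] (yes a≤x) = sym ([≤]-yes a≤x)
  𝟙-[≤] (no  a≰x) = sym ([≤]-no (≰⇒> a≰x))

𝟙-≟ : ∀ a z → 𝟙 (a ≟ z) ≡ [ a ≡ z ]
𝟙-≟ zero    zero    = refl
𝟙-≟ zero    (suc z) = refl
𝟙-≟ (suc a) zero    = refl
𝟙-≟ (suc a) (suc z) = 𝟙-≟ a z

∑∈ : {A : Set} → List A → (A → ℕ) → ℕ
∑∈ xs g = sum (map g xs)

infix 5 ∑∈
syntax ∑∈ xs (λ x → e) = ∑[ x ∈ xs ] e

length-filter≡∑𝟙 : ∀ {A : Set} {P : A → Set} (P? : ∀ x → Dec (P x)) xs →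
                   length (filter P? xs) ≡ ∑[ x ∈ xs ] 𝟙 (P? x)
length-filter≡∑𝟙 P? []       = refl
length-filter≡∑𝟙 P? (x ∷ xs) with does (P? x)
... | true  = cong suc (length-filter≡∑𝟙 P? xs)
... | false = length-filter≡∑𝟙 P? xs

∑∈-cong : ∀ {A : Set} {g h : A → ℕ} xs → (∀ x → g x ≡ h x) → ∑∈ xs g ≡ ∑∈ xs h
∑∈-cong xs eq = cong sum (map-cong eq xs)

∑∈-zero : ∀ {A : Set} (xs : List A) → ∑[ _ ∈ xs ] 0 ≡ 0
∑∈-zero []       = refl
∑∈-zero (_ ∷ xs) = ∑∈-zero xs

∑∈-++ : ∀ {A : Set} (g : A → ℕ) xs ys → ∑∈ (xs ++ ys) g ≡ ∑∈ xs g + ∑∈ ys g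
∑∈-++ g xs ys = trans (cong sum (map-++ g xs ys)) (sum-++ (map g xs) (map g ys))

∑∈-map : ∀ {A B : Set} (g : B → ℕ) (h : A → B) xs → ∑∈ (map h xs) g ≡ ∑[ x ∈ xs ] g (h x)
∑∈-map g h xs = cong sum (sym (map-∘ xs))

∑∈-concatMap : ∀ {A B : Set} (g : B → ℕ) (h : A → List B) xs →
               ∑∈ (concatMap h xs) g ≡ ∑[ x ∈ xs ] ∑∈ (h x) g
∑∈-concatMap g h []       = refl
∑∈-concatMap g h (x ∷ xs) =
  trans (∑∈-++ g (h x) (concatMap h xs)) (cong (∑∈ (h x) g +_) (∑∈-concatMap g h xs))

*-distribˡ-∑∈ : ∀ {A : Set} k (g : A → ℕ) xs → k * ∑∈ xs g ≡ ∑[ x ∈ xs ] k * g x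
*-distribˡ-∑∈ k g []       = *-zeroʳ k
*-distribˡ-∑∈ k g (x ∷ xs) = trans (*-distribˡ-+ k (g x) _) (cong (k * g x +_) (*-distribˡ-∑∈ k g xs))

∑∈-oneTo : ∀ m (g : ℕ → ℕ) → ∑∈ (oneTo m) g ≡ ∑[ i < m ] g (suc i)
∑∈-oneTo m g = trans (∑∈-map g suc (upTo m)) (cong sum (map-applyUpTo (λ i → i) (g ∘ suc) m))

-- Lists of length k with entries in [0, b) satisfying NonSquashingFrom acc.
#nsLists : ℕ → ℕ → ℕ → ℕ
#nsLists acc zero    b = 1
#nsLists acc (suc k) b = ∑[ x < b ] [ acc ≤ x ] * #nsLists (acc + x) k b

#nsLists-one : ∀ acc b → #nsLists acc 1 b ≡ b ∸ acc
#nsLists-one zero    b       = trans (∑-const b 1) (*-identityʳ b)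
#nsLists-one (suc a) zero    = refl
#nsLists-one (suc a) (suc b) = #nsLists-one a b

#nsLists-vanish : ∀ {acc b} k → b ≤ acc → #nsLists acc (suc k) b ≡ 0
#nsLists-vanish {acc} {b} k b≤acc =
  ∑≡0 b (λ x x<b → cong (_* #nsLists (acc + x) k b) ([≤]-no (<-≤-trans x<b b≤acc)))

-- Subtracting d·2^(i−1) from the i-th entry preserves non-squashing while lowering the
-- start from d + acc to acc; as the lists are nondecreasing, only the bound on the last
-- entry matters (both sides vanish when b ≤ d·2^j).
#nsLists-shift : ∀ j d acc b → #nsLists (d + acc) (suc j) b ≡ #nsLists acc (suc j) (b ∸ d * 2 ^ j)
#nsLists-shift zero d acc b = begin
  #nsLists (d + acc) 1 b       ≡⟨ #nsLists-one (d + acc) b ⟩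
  b ∸ (d + acc)                ≡⟨ ∸-+-assoc b d acc ⟨
  b ∸ d ∸ acc                  ≡⟨ cong (λ t → b ∸ t ∸ acc) (*-identityʳ d) ⟨
  b ∸ d * 1 ∸ acc              ≡⟨ #nsLists-one acc (b ∸ d * 1) ⟨
  #nsLists acc 1 (b ∸ d * 1)   ∎
  where open ≡-Reasoning
#nsLists-shift (suc j) d acc b = begin
  ∑[ y < b ] [ d + acc ≤ y ] * #nsLists (d + acc + y) (suc j) b
    ≡⟨ ∑-[≤]-shift d acc b (λ y → #nsLists (d + acc + y) (suc j) b) ⟩
  ∑[ i < b ∸ d ] [ acc ≤ i ] * #nsLists (d + acc + (d + i)) (suc j) b
    ≡⟨ ∑-cong (b ∸ d) (λ i _ → cong ([ acc ≤ i ] *_) (shifted i)) ⟩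
  ∑[ i < b ∸ d ] [ acc ≤ i ] * #nsLists (acc + i) (suc j) b'
    ≡⟨ ∑-truncate _ b'≤b∸d (λ i b'≤i _ →
         [≤]*-vanish acc i (λ _ → #nsLists-vanish j (≤-trans b'≤i (m≤n+m i acc)))) ⟩
  ∑[ i < b' ] [ acc ≤ i ] * #nsLists (acc + i) (suc j) b'
    ∎
  where
  open ≡-Reasoning
  b' : ℕ
  b' = b ∸ d * 2 ^ suc j
  b'≤b∸d : b' ≤ b ∸ d
  b'≤b∸d = ∸-monoʳ-≤ b (m≤m*n d (2 ^ suc j) {{m^n≢0 2 (suc j)}})
  shifted : ∀ i → #nsLists (d + acc + (d + i)) (suc j) b ≡ #nsLists (acc + i) (suc j) b'
  shifted i = begin
    #nsLists (d + acc + (d + i)) (suc j) b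
      ≡⟨ cong (λ t → #nsLists t (suc j) b) (+-interchange d acc d i) ⟩
    #nsLists (d + d + (acc + i)) (suc j) b
      ≡⟨ #nsLists-shift j (d + d) (acc + i) b ⟩
    #nsLists (acc + i) (suc j) (b ∸ (d + d) * 2 ^ j)
      ≡⟨ cong (λ t → #nsLists (acc + i) (suc j) (b ∸ t)) (doubling d (2 ^ j)) ⟩
    #nsLists (acc + i) (suc j) b'
      ∎
    where
    doubling : ∀ d p → (d + d) * p ≡ d * (2 * p)
    doubling = solve-∀

-- Lists x₁ … x_j satisfying NonSquashingFrom acc with acc + x₁ + ⋯ + x_j = z.
#nsListsWithTotal : ℕ → ℕ → ℕ → ℕ
#nsListsWithTotal acc zero    z = [ acc ≡ z ]
#nsListsWithTotal acc (suc j) z = ∑[ x < suc z ] [ acc ≤ x ] * #nsListsWithTotal (acc + x) j z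

#nsListsWithTotal-below : ∀ j {acc z} → z < acc → #nsListsWithTotal acc j z ≡ 0
#nsListsWithTotal-below zero    z<acc = [≡]-no z<acc
#nsListsWithTotal-below (suc j) {acc} {z} z<acc = ∑≡0 (suc z) (λ x _ →
  [≤]*-vanish acc x (λ _ → #nsListsWithTotal-below j (≤-trans z<acc (m≤m+n acc x))))

#nsListsWithTotal-belowLength : ∀ j {acc z} → 1 ≤ acc → z < acc + j → #nsListsWithTotal acc j z ≡ 0
#nsListsWithTotal-belowLength zero    {acc} _ z<acc+0 = [≡]-no (subst (_ <_) (+-identityʳ acc) z<acc+0)
#nsListsWithTotal-belowLength (suc j) {acc} {z} 1≤acc z<acc+1+j = ∑≡0 (suc z) (λ x _ →
  [≤]*-vanish acc x (λ acc≤x → #nsListsWithTotal-belowLength j (≤-trans 1≤acc (m≤m+n acc x)) (begin-strict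
    z                 <⟨ z<acc+1+j ⟩
    acc + suc j       ≡⟨ +-assoc acc 1 j ⟨
    acc + 1 + j       ≤⟨ +-monoˡ-≤ j (+-monoʳ-≤ acc (≤-trans 1≤acc acc≤x)) ⟩
    acc + x + j       ∎)))
  where open ≤-Reasoning

-- Sort by the running total z before the last entry, which then ranges over [z, b).
#nsLists≡∑#nsListsWithTotal : ∀ j acc b →
  #nsLists acc (suc j) b ≡ ∑[ z < b ] #nsListsWithTotal acc j z * (b ∸ z)
#nsLists≡∑#nsListsWithTotal zero acc b with acc <? b
... | yes acc<b = trans (#nsLists-one acc b) (sym (∑-[≡] acc b (b ∸_) acc<b))
... | no  acc≮b = trans (#nsLists-one acc b) (trans (m≤n⇒m∸n≡0 b≤acc)
                    (sym (∑≡0 b (λ z z<b → cong (_* (b ∸ z)) ([≡]-no (<-≤-trans z<b b≤acc))))))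
  where
  b≤acc : b ≤ acc
  b≤acc = ≮⇒≥ acc≮b
#nsLists≡∑#nsListsWithTotal (suc j) acc b = begin
  ∑[ x < b ] [ acc ≤ x ] * #nsLists (acc + x) (suc j) b
    ≡⟨ ∑-cong b (λ x _ → cong ([ acc ≤ x ] *_) (#nsLists≡∑#nsListsWithTotal j (acc + x) b)) ⟩
  ∑[ x < b ] [ acc ≤ x ] * (∑[ z < b ] E (acc + x) z * (b ∸ z))
    ≡⟨ ∑-cong b (λ x _ → *-distribˡ-∑ b [ acc ≤ x ] _) ⟩
  ∑[ x < b ] ∑[ z < b ] [ acc ≤ x ] * (E (acc + x) z * (b ∸ z))
    ≡⟨ ∑-comm b b _ ⟩
  ∑[ z < b ] ∑[ x < b ] [ acc ≤ x ] * (E (acc + x) z * (b ∸ z))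
    ≡⟨ ∑-cong b (λ z z<b → lastEntry z z<b) ⟩
  ∑[ z < b ] #nsListsWithTotal acc (suc j) z * (b ∸ z)
    ∎
  where
  open ≡-Reasoning
  E : ℕ → ℕ → ℕ
  E acc' z = #nsListsWithTotal acc' j z
  lastEntry : ∀ z → z < b →
              ∑[ x < b ] [ acc ≤ x ] * (E (acc + x) z * (b ∸ z)) ≡ #nsListsWithTotal acc (suc j) z * (b ∸ z)
  lastEntry z z<b = begin
    ∑[ x < b ] [ acc ≤ x ] * (E (acc + x) z * (b ∸ z))
      ≡⟨ ∑-cong b (λ x _ → sym (*-assoc [ acc ≤ x ] _ (b ∸ z))) ⟩
    ∑[ x < b ] [ acc ≤ x ] * E (acc + x) z * (b ∸ z)
      ≡⟨ ∑-truncate _ z<b (λ x z<x _ → cong (_* (b ∸ z))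
           ([≤]*-vanish acc x (λ _ → #nsListsWithTotal-below j (<-≤-trans z<x (m≤n+m x acc))))) ⟩
    ∑[ x < suc z ] [ acc ≤ x ] * E (acc + x) z * (b ∸ z)
      ≡⟨ *-distribʳ-∑ (suc z) (b ∸ z) (λ x → [ acc ≤ x ] * E (acc + x) z) ⟨
    #nsListsWithTotal acc (suc j) z * (b ∸ z)
      ∎

nonSquashingFrom⇒linked : ∀ acc xs → NonSquashingFrom acc xs → Linked _≤_ xs
nonSquashingFrom⇒linked acc []           _                    = []
nonSquashingFrom⇒linked acc (x ∷ [])     _                    = [-]
nonSquashingFrom⇒linked acc (x ∷ y ∷ ys) (_ , acc+x≤y , rest) =
  ≤-trans (m≤n+m x acc) acc+x≤y ∷ nonSquashingFrom⇒linked (acc + x) (y ∷ ys) (acc+x≤y , rest)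

#nsTuples : ℕ → ℕ → ℕ → List ℕ → ℕ
#nsTuples acc z p cs = ∑[ ys ∈ listsOfLength p cs ] 𝟙 ((acc + sum ys ≟ z) ×-dec nonSquashingFrom? acc ys)

a≡#nsTuples : ∀ m p → a m p ≡ #nsTuples 0 m p (oneTo m)
a≡#nsTuples m p = trans (length-filter≡∑𝟙 _ (listsOfLength p (oneTo m))) (∑∈-cong (listsOfLength p (oneTo m)) (λ ys →
  𝟙-×-dec-redundant (linked? _≤?_ ys) ((sum ys ≟ m) ×-dec nonSquashing? ys)
                    (nonSquashingFrom⇒linked 0 ys ∘ proj₂)))

#nsTuples-zero : ∀ acc z cs → #nsTuples acc z 0 cs ≡ [ acc ≡ z ]
#nsTuples-zero acc z cs = begin
  𝟙 ((acc + 0 ≟ z) ×-dec yes tt) + 0   ≡⟨ +-identityʳ _ ⟩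
  𝟙 ((acc + 0 ≟ z) ×-dec yes tt)       ≡⟨ 𝟙-×-dec (acc + 0 ≟ z) (yes tt) ⟩
  𝟙 (acc + 0 ≟ z) * 1                  ≡⟨ *-identityʳ _ ⟩
  𝟙 (acc + 0 ≟ z)                      ≡⟨ cong (λ t → 𝟙 (t ≟ z)) (+-identityʳ acc) ⟩
  𝟙 (acc ≟ z)                          ≡⟨ 𝟙-≟ acc z ⟩
  [ acc ≡ z ]                          ∎
  where open ≡-Reasoning

#nsTuples-suc : ∀ acc z p cs →
                #nsTuples acc z (suc p) cs ≡ ∑[ c ∈ cs ] [ acc ≤ c ] * #nsTuples (acc + c) z p cs
#nsTuples-suc acc z p cs = begin
  ∑∈ (concatMap (λ c → map (c ∷_) tuples) cs) (good acc)
    ≡⟨ ∑∈-concatMap (good acc) (λ c → map (c ∷_) tuples) cs ⟩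
  ∑[ c ∈ cs ] ∑∈ (map (c ∷_) tuples) (good acc)
    ≡⟨ ∑∈-cong cs (λ c → ∑∈-map (good acc) (c ∷_) tuples) ⟩
  ∑[ c ∈ cs ] ∑[ ys ∈ tuples ] good acc (c ∷ ys)
    ≡⟨ ∑∈-cong cs (λ c → ∑∈-cong tuples (good-∷ c)) ⟩
  ∑[ c ∈ cs ] ∑[ ys ∈ tuples ] [ acc ≤ c ] * good (acc + c) ys
    ≡⟨ ∑∈-cong cs (λ c → *-distribˡ-∑∈ [ acc ≤ c ] (good (acc + c)) tuples) ⟨
  ∑[ c ∈ cs ] [ acc ≤ c ] * #nsTuples (acc + c) z p cs
    ∎
  where
  open ≡-Reasoning
  tuples : List (List ℕ)
  tuples = listsOfLength p cs
  good : ℕ → List ℕ → ℕ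
  good acc' ys = 𝟙 ((acc' + sum ys ≟ z) ×-dec nonSquashingFrom? acc' ys)
  good-∷ : ∀ c ys → good acc (c ∷ ys) ≡ [ acc ≤ c ] * good (acc + c) ys
  good-∷ c ys = trans (𝟙-×-dec-middle (acc + (c + sum ys) ≟ z) (acc ≤? c) (nonSquashingFrom? (acc + c) ys))
    (cong₂ _*_ (𝟙-≤? acc c)
               (cong (λ t → 𝟙 ((t ≟ z) ×-dec nonSquashingFrom? (acc + c) ys)) (sym (+-assoc acc c (sum ys)))))

#nsTuples≡#nsListsWithTotal : ∀ p {acc z m} → 1 ≤ acc → z ≤ m →
                              #nsTuples acc z p (oneTo m) ≡ #nsListsWithTotal acc p z
#nsTuples≡#nsListsWithTotal zero    {acc} {z} {m} _ _ = #nsTuples-zero acc z (oneTo m)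
#nsTuples≡#nsListsWithTotal (suc p) {suc a} {z} {m} _ z≤m = begin
  #nsTuples (suc a) z (suc p) (oneTo m)
    ≡⟨ #nsTuples-suc (suc a) z p (oneTo m) ⟩
  ∑[ c ∈ oneTo m ] [ suc a ≤ c ] * #nsTuples (suc a + c) z p (oneTo m)
    ≡⟨ ∑∈-oneTo m _ ⟩
  ∑[ i < m ] [ a ≤ i ] * #nsTuples (suc a + suc i) z p (oneTo m)
    ≡⟨ ∑-cong m (λ i _ → cong ([ a ≤ i ] *_) (#nsTuples≡#nsListsWithTotal p (s≤s z≤n) z≤m)) ⟩
  ∑[ i < m ] [ a ≤ i ] * #nsListsWithTotal (suc a + suc i) p z
    ≡⟨ ∑-truncate _ z≤m (λ i z≤i _ → [≤]*-vanish a i (λ _ →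
         #nsListsWithTotal-below p (s≤s (≤-trans (m≤n⇒m≤1+n z≤i) (m≤n+m (suc i) a))))) ⟩
  #nsListsWithTotal (suc a) (suc p) z
    ∎
  where open ≡-Reasoning

a-zero : ∀ m → a m 0 ≡ [ 0 ≡ m ]
a-zero m = trans (a≡#nsTuples m 0) (#nsTuples-zero 0 m (oneTo m))

a-suc : ∀ m p → a m (suc p) ≡ ∑[ i < m ] #nsListsWithTotal (suc i) p m
a-suc m p = begin
  a m (suc p)                                             ≡⟨ a≡#nsTuples m (suc p) ⟩
  #nsTuples 0 m (suc p) (oneTo m)                         ≡⟨ #nsTuples-suc 0 m p (oneTo m) ⟩
  ∑[ c ∈ oneTo m ] [ 0 ≤ c ] * #nsTuples c m p (oneTo m)  ≡⟨ ∑∈-oneTo m _ ⟩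
  ∑[ i < m ] 1 * #nsTuples (suc i) m p (oneTo m)          ≡⟨ ∑-cong m (λ i _ →
       trans (*-identityˡ _) (#nsTuples≡#nsListsWithTotal p (s≤s z≤n) ≤-refl)) ⟩
  ∑[ i < m ] #nsListsWithTotal (suc i) p m                ∎
  where open ≡-Reasoning

a-vanish : ∀ {m p} → m < p → a m p ≡ 0
a-vanish {m} {suc p} m<1+p = trans (a-suc m p) (∑≡0 m (λ i _ →
  #nsListsWithTotal-belowLength p (s≤s z≤n) (≤-trans m<1+p (s≤s (m≤n+m p i)))))

-- A list counted on the left is a run of zeros followed by a non-squashing partition of m
-- into p ≤ j parts.
#nsListsWithTotal-zero≡∑a : ∀ j m → #nsListsWithTotal 0 j m ≡ ∑[ p < suc j ] a m p
#nsListsWithTotal-zero≡∑a zero    m = sym (trans (+-identityʳ (a m 0)) (a-zero m))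
#nsListsWithTotal-zero≡∑a (suc j) m = begin
  ∑[ x < suc m ] 1 * #nsListsWithTotal x j m
    ≡⟨ ∑-cong (suc m) {h = λ x → #nsListsWithTotal x j m} (λ x _ → *-identityˡ _) ⟩
  #nsListsWithTotal 0 j m + (∑[ i < m ] #nsListsWithTotal (suc i) j m)
    ≡⟨ cong₂ _+_ (#nsListsWithTotal-zero≡∑a j m) (sym (a-suc m j)) ⟩
  ∑< (suc j) (a m) + a m (suc j)
    ≡⟨ ∑-suc (suc j) (a m) ⟨
  ∑< (suc (suc j)) (a m)
    ∎
  where open ≡-Reasoning

sumFromTo-a : ∀ p N (w : ℕ → ℕ) → sumFromTo p N (λ m → w m * a m p) ≡ ∑[ m < suc N ] w m * a m p
sumFromTo-a p N w = trans (sumFromTo≡∑ p N (λ m → w m * a m p)) (∑-dropLeadingZeros p (suc N) (λ m → w m * a m p)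
  (λ m m<p → trans (cong (w m *_) (a-vanish m<p)) (*-zeroʳ (w m))))

∑-a-vanish : ∀ {N p} (w : ℕ → ℕ) → N < p → ∑[ m < suc N ] w m * a m p ≡ 0
∑-a-vanish {N} w N<p =
  ∑≡0 (suc N) (λ m m≤N → trans (cong (w m *_) (a-vanish (<-≤-trans m≤N N<p))) (*-zeroʳ (w m)))

∑∑a≡#nsLists : ∀ j N →
  sumFromTo 0 (j ⊓ N) (λ p → sumFromTo p N (λ m → (N + 1 ∸ m) * a m p)) ≡ #nsLists 0 (suc j) (suc N)
∑∑a≡#nsLists j N = begin
  sumFromTo 0 (j ⊓ N) (λ p → sumFromTo p N (λ m → w m * a m p))
    ≡⟨ sumFromTo≡∑ 0 (j ⊓ N) (λ p → sumFromTo p N (λ m → w m * a m p)) ⟩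
  ∑[ p < suc (j ⊓ N) ] sumFromTo p N (λ m → w m * a m p)
    ≡⟨ ∑-cong (suc (j ⊓ N)) (λ p _ → sumFromTo-a p N w) ⟩
  ∑[ p < suc (j ⊓ N) ] ∑[ m < suc N ] w m * a m p
    ≡⟨ ∑-truncate (λ p → ∑[ m < suc N ] w m * a m p) (s≤s (m⊓n≤m j N))
                  (λ p j⊓N<p p<1+j → ∑-a-vanish w (N<p j⊓N<p p<1+j)) ⟨
  ∑[ p < suc j ] ∑[ m < suc N ] w m * a m p
    ≡⟨ ∑-comm (suc j) (suc N) (λ p m → w m * a m p) ⟩
  ∑[ m < suc N ] ∑[ p < suc j ] w m * a m p
    ≡⟨ ∑-cong (suc N) (λ m _ → weighted m) ⟩
  ∑[ m < suc N ] #nsListsWithTotal 0 j m * (suc N ∸ m)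
    ≡⟨ #nsLists≡∑#nsListsWithTotal j 0 (suc N) ⟨
  #nsLists 0 (suc j) (suc N)
    ∎
  where
  open ≡-Reasoning
  w : ℕ → ℕ
  w m = N + 1 ∸ m
  N<p : ∀ {p} → j ⊓ N < p → p < suc j → N < p
  N<p j⊓N<p (s≤s p≤j) = ≰⇒> (λ p≤N → <⇒≱ j⊓N<p (⊓-glb p≤j p≤N))
  weighted : ∀ m → ∑[ p < suc j ] w m * a m p ≡ #nsListsWithTotal 0 j m * (suc N ∸ m)
  weighted m = begin
    ∑[ p < suc j ] w m * a m p            ≡⟨ *-distribˡ-∑ (suc j) (w m) (a m) ⟨
    w m * ∑< (suc j) (a m)                ≡⟨ cong (w m *_) (#nsListsWithTotal-zero≡∑a j m) ⟨
    w m * #nsListsWithTotal 0 j m         ≡⟨ *-comm (w m) _ ⟩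
    #nsListsWithTotal 0 j m * w m         ≡⟨ cong (λ t → #nsListsWithTotal 0 j m * (t ∸ m)) (+-comm N 1) ⟩
    #nsListsWithTotal 0 j m * (suc N ∸ m) ∎

interval : ℕ → ℕ → List ℕ
interval lo zero    = []
interval lo (suc c) = lo ∷ interval (suc lo) c

applyUpTo-interval : ∀ lo c (g : ℕ → ℕ) → (∀ i → g i ≡ lo + i) → applyUpTo g c ≡ interval lo c
applyUpTo-interval lo zero    g g≡lo+ = refl
applyUpTo-interval lo (suc c) g g≡lo+ = cong₂ _∷_ (trans (g≡lo+ 0) (+-identityʳ lo))
  (applyUpTo-interval (suc lo) c (g ∘ suc) (λ i → trans (g≡lo+ (suc i)) (+-suc lo i)))

oneTo≡interval : ∀ n → oneTo n ≡ interval 1 n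
oneTo≡interval n = trans (map-applyUpTo (λ i → i) suc n) (applyUpTo-interval 1 n suc (λ _ → refl))

#nsSublists : ℕ → ℕ → List ℕ → ℕ
#nsSublists acc k xs = ∑[ ys ∈ sublists xs ] 𝟙 ((length ys ≟ k) ×-dec nonSquashingFrom? acc ys)

f≡#nsSublists : ∀ n k → f n k ≡ #nsSublists 0 k (interval 1 n)
f≡#nsSublists n k =
  trans (length-filter≡∑𝟙 _ (sublists (oneTo n))) (cong (#nsSublists 0 k) (oneTo≡interval n))

#nsSublists-zero : ∀ acc xs → #nsSublists acc 0 xs ≡ 1
#nsSublists-zero acc []       = refl
#nsSublists-zero acc (x ∷ xs) = trans (∑∈-++ _ (sublists xs) (map (x ∷_) (sublists xs)))
  (cong₂ _+_ (#nsSublists-zero acc xs) (trans (∑∈-map _ (x ∷_) (sublists xs)) (∑∈-zero (sublists xs))))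

#nsSublists-∷ : ∀ acc k x xs → #nsSublists acc (suc k) (x ∷ xs)
                              ≡ #nsSublists acc (suc k) xs + [ acc ≤ x ] * #nsSublists (acc + x) k xs
#nsSublists-∷ acc k x xs = begin
  ∑∈ (sublists xs ++ map (x ∷_) (sublists xs)) (good acc (suc k))
    ≡⟨ ∑∈-++ (good acc (suc k)) (sublists xs) (map (x ∷_) (sublists xs)) ⟩
  #nsSublists acc (suc k) xs + ∑∈ (map (x ∷_) (sublists xs)) (good acc (suc k))
    ≡⟨ cong (#nsSublists acc (suc k) xs +_) (∑∈-map (good acc (suc k)) (x ∷_) (sublists xs)) ⟩
  #nsSublists acc (suc k) xs + (∑[ ys ∈ sublists xs ] good acc (suc k) (x ∷ ys))
    ≡⟨ cong (#nsSublists acc (suc k) xs +_) (∑∈-cong (sublists xs) good-∷) ⟩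
  #nsSublists acc (suc k) xs + (∑[ ys ∈ sublists xs ] [ acc ≤ x ] * good (acc + x) k ys)
    ≡⟨ cong (#nsSublists acc (suc k) xs +_) (*-distribˡ-∑∈ [ acc ≤ x ] (good (acc + x) k) (sublists xs)) ⟨
  #nsSublists acc (suc k) xs + [ acc ≤ x ] * #nsSublists (acc + x) k xs
    ∎
  where
  open ≡-Reasoning
  good : ℕ → ℕ → List ℕ → ℕ
  good acc' k' ys = 𝟙 ((length ys ≟ k') ×-dec nonSquashingFrom? acc' ys)
  good-∷ : ∀ ys → good acc (suc k) (x ∷ ys) ≡ [ acc ≤ x ] * good (acc + x) k ys
  good-∷ ys = trans (𝟙-×-dec-middle (length ys ≟ k) (acc ≤? x) (nonSquashingFrom? (acc + x) ys))
                    (cong (_* good (acc + x) k ys) (𝟙-≤? acc x))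

-- Strictly increasing lists of length k over [lo, b) satisfying NonSquashingFrom acc.
#nsIncreasing : ℕ → ℕ → ℕ → ℕ → ℕ
#nsIncreasing lo acc zero    b = 1
#nsIncreasing lo acc (suc k) b = ∑[ x < b ] [ lo ≤ x ] * ([ acc ≤ x ] * #nsIncreasing (suc x) (acc + x) k b)

#nsIncreasing-split : ∀ lo acc k b → lo < b → #nsIncreasing lo acc (suc k) b
  ≡ #nsIncreasing (suc lo) acc (suc k) b + [ acc ≤ lo ] * #nsIncreasing (suc lo) (acc + lo) k b
#nsIncreasing-split lo acc k b lo<b = begin
  ∑[ x < b ] [ lo ≤ x ] * t x
    ≡⟨ ∑-cong b (λ x _ →
         trans (cong (_* t x) ([≤]-suc lo x)) (*-distribʳ-+ (t x) [ suc lo ≤ x ] [ lo ≡ x ])) ⟩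
  ∑[ x < b ] ([ suc lo ≤ x ] * t x + [ lo ≡ x ] * t x)
    ≡⟨ ∑-distrib-+ b (λ x → [ suc lo ≤ x ] * t x) (λ x → [ lo ≡ x ] * t x) ⟩
  #nsIncreasing (suc lo) acc (suc k) b + (∑[ x < b ] [ lo ≡ x ] * t x)
    ≡⟨ cong (#nsIncreasing (suc lo) acc (suc k) b +_) (∑-[≡] lo b t lo<b) ⟩
  #nsIncreasing (suc lo) acc (suc k) b + t lo
    ∎
  where
  open ≡-Reasoning
  t : ℕ → ℕ
  t x = [ acc ≤ x ] * #nsIncreasing (suc x) (acc + x) k b

#nsSublists-interval : ∀ c lo acc k → #nsSublists acc k (interval lo c) ≡ #nsIncreasing lo acc k (lo + c)
#nsSublists-interval c       lo acc zero    = #nsSublists-zero acc (interval lo c)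
#nsSublists-interval zero    lo acc (suc k) = sym (∑≡0 (lo + 0) (λ x x<lo+0 →
  [≤]*-vanish lo x (λ lo≤x → contradiction (subst (x <_) (+-identityʳ lo) x<lo+0) (≤⇒≯ lo≤x))))
#nsSublists-interval (suc c) lo acc (suc k) = begin
  #nsSublists acc (suc k) (lo ∷ interval (suc lo) c)
    ≡⟨ #nsSublists-∷ acc k lo (interval (suc lo) c) ⟩
  #nsSublists acc (suc k) (interval (suc lo) c) + [ acc ≤ lo ] * #nsSublists (acc + lo) k (interval (suc lo) c)
    ≡⟨ cong₂ (λ s t → s + [ acc ≤ lo ] * t) (#nsSublists-interval c (suc lo) acc (suc k))
                                            (#nsSublists-interval c (suc lo) (acc + lo) k) ⟩
  #nsIncreasing (suc lo) acc (suc k) (suc lo + c) + [ acc ≤ lo ] * #nsIncreasing (suc lo) (acc + lo) k (suc lo + c)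
    ≡⟨ #nsIncreasing-split lo acc k (suc lo + c) (s≤s (m≤m+n lo c)) ⟨
  #nsIncreasing lo acc (suc k) (suc lo + c)
    ≡⟨ cong (#nsIncreasing lo acc (suc k)) (+-suc lo c) ⟨
  #nsIncreasing lo acc (suc k) (lo + suc c)
    ∎
  where open ≡-Reasoning

-- With a positive running total every entry exceeds the previous one, and the first is ≥ acc ≥ lo.
#nsIncreasing≡#nsLists : ∀ k {lo acc b} → 1 ≤ acc → lo ≤ acc → #nsIncreasing lo acc k b ≡ #nsLists acc k b
#nsIncreasing≡#nsLists zero    _     _      = refl
#nsIncreasing≡#nsLists (suc k) {lo} {acc} {b} 1≤acc lo≤acc = ∑-cong b (λ x _ → begin
  [ lo ≤ x ] * ([ acc ≤ x ] * #nsIncreasing (suc x) (acc + x) k b)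
    ≡⟨ x*[y*z]≡y*[x*z] [ lo ≤ x ] [ acc ≤ x ] _ ⟩
  [ acc ≤ x ] * ([ lo ≤ x ] * #nsIncreasing (suc x) (acc + x) k b)
    ≡⟨ [≤]*-cong acc x (λ acc≤x → trans (cong (_* _) ([≤]-yes (≤-trans lo≤acc acc≤x))) (trans (*-identityˡ _)
         (#nsIncreasing≡#nsLists k (≤-trans 1≤acc (m≤m+n acc x)) (+-monoˡ-≤ x 1≤acc)))) ⟩
  [ acc ≤ x ] * #nsLists (acc + x) k b
    ∎)
  where open ≡-Reasoning

f≡#nsIncreasing : ∀ n k → f n k ≡ #nsIncreasing 1 0 k (suc n)
f≡#nsIncreasing n k = trans (f≡#nsSublists n k) (#nsSublists-interval n 1 0 k)

f-zero : ∀ n → f n 0 ≡ 1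
f-zero n = trans (f≡#nsSublists n 0) (#nsSublists-zero 0 (interval 1 n))

-- The two smallest elements are p₁ = 1 + i and p₂ = 2 + y, and p₁ < p₂ becomes i ≤ y.
f-twoPlus : ∀ n k → f n (2 + k) ≡ ∑[ i < n ] ∑[ y < n ∸ 1 ] [ i ≤ y ] * #nsLists (3 + (i + y)) k (suc n)
f-twoPlus n k = begin
  f n (2 + k)
    ≡⟨ f≡#nsIncreasing n (2 + k) ⟩
  ∑[ i < n ] 1 * (1 * (∑[ y < suc n ] [ 2 + i ≤ y ] * ([ 1 + i ≤ y ] * #nsIncreasing (suc y) (suc i + y) k (suc n))))
    ≡⟨ ∑-cong n (λ i _ →
         trans (*-identityˡ _) (trans (*-identityˡ _) (∑-cong (suc n) (λ y _ → secondEntry i y)))) ⟩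
  ∑[ i < n ] ∑[ y < suc n ] [ 2 + i ≤ y ] * #nsLists (suc i + y) k (suc n)
    ≡⟨ ∑-cong n (λ i _ → ∑-[≤]-shift 2 i (suc n) (λ y → #nsLists (suc i + y) k (suc n))) ⟩
  ∑[ i < n ] ∑[ y < n ∸ 1 ] [ i ≤ y ] * #nsLists (suc i + (2 + y)) k (suc n)
    ≡⟨ ∑-cong n (λ i _ → ∑-cong (n ∸ 1) (λ y _ →
         cong (λ t → [ i ≤ y ] * #nsLists t k (suc n)) (rearrange i y))) ⟩
  ∑[ i < n ] ∑[ y < n ∸ 1 ] [ i ≤ y ] * #nsLists (3 + (i + y)) k (suc n)
    ∎
  where
  open ≡-Reasoning
  secondEntry : ∀ i y → [ 2 + i ≤ y ] * ([ 1 + i ≤ y ] * #nsIncreasing (suc y) (suc i + y) k (suc n))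
                      ≡ [ 2 + i ≤ y ] * #nsLists (suc i + y) k (suc n)
  secondEntry i y = [≤]*-cong (2 + i) y (λ 2+i≤y → begin
    [ 1 + i ≤ y ] * rest   ≡⟨ cong (_* rest) ([≤]-yes (≤-trans (n≤1+n (suc i)) 2+i≤y)) ⟩
    1 * rest               ≡⟨ *-identityˡ rest ⟩
    rest                   ≡⟨ #nsIncreasing≡#nsLists k (s≤s z≤n) (s≤s (m≤n+m y i)) ⟩
    #nsLists (suc i + y) k (suc n) ∎)
    where
    rest : ℕ
    rest = #nsIncreasing (suc y) (suc i + y) k (suc n)
  rearrange : ∀ i y → suc i + (2 + y) ≡ 3 + (i + y)
  rearrange = solve-∀

#nsLists-twoPlus : ∀ k b → #nsLists 0 (2 + k) b ≡ ∑[ x < b ] ∑[ y < b ] [ x ≤ y ] * #nsLists (x + y) k b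
#nsLists-twoPlus k b = ∑-cong b (λ x _ → *-identityˡ _)

∑∑[≤]-truncate : ∀ {b c} (g : ℕ → ℕ → ℕ) → b ≤ c →
                 ∑[ i < c ] ∑[ y < b ] [ i ≤ y ] * g i y ≡ ∑[ i < b ] ∑[ y < b ] [ i ≤ y ] * g i y
∑∑[≤]-truncate {b} g b≤c =
  ∑-truncate _ b≤c (λ i b≤i _ → ∑≡0 b (λ y y<b → cong (_* g i y) ([≤]-no (<-≤-trans y<b b≤i))))

-- For k = suc j the bound is n − γ(k) + 1, truncated to 0 (making the count 0) when n < γ(k).
f≡#nsLists : ∀ n j → f n (suc j) ≡ #nsLists 0 (suc j) (suc n ∸ γ (suc j))
f≡#nsLists n zero = f≡#nsIncreasing n 1
f≡#nsLists n (suc zero) = begin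
  f n 2                                              ≡⟨ f-twoPlus n 0 ⟩
  ∑[ i < n ] ∑[ y < n ∸ 1 ] [ i ≤ y ] * 1            ≡⟨ ∑∑[≤]-truncate (λ _ _ → 1) (m∸n≤m n 1) ⟩
  ∑[ i < n ∸ 1 ] ∑[ y < n ∸ 1 ] [ i ≤ y ] * 1        ≡⟨ #nsLists-twoPlus 0 (n ∸ 1) ⟨
  #nsLists 0 2 (n ∸ 1)                               ∎
  where open ≡-Reasoning
f≡#nsLists n (suc (suc j)) = begin
  f n (3 + j)
    ≡⟨ f-twoPlus n (suc j) ⟩
  ∑[ i < n ] ∑[ y < n ∸ 1 ] [ i ≤ y ] * #nsLists (3 + (i + y)) (suc j) (suc n)
    ≡⟨ ∑-cong n (λ i _ → ∑-cong (n ∸ 1) (λ y _ → cong ([ i ≤ y ] *_) (#nsLists-shift j 3 (i + y) (suc n)))) ⟩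
  ∑[ i < n ] ∑[ y < n ∸ 1 ] [ i ≤ y ] * #nsLists (i + y) (suc j) b
    ≡⟨ ∑-cong n (λ i _ → ∑-truncate _ b≤n∸1 (λ y b≤y _ →
         [≤]*-vanish i y (λ _ → #nsLists-vanish j (≤-trans b≤y (m≤n+m y i))))) ⟩
  ∑[ i < n ] ∑[ y < b ] [ i ≤ y ] * #nsLists (i + y) (suc j) b
    ≡⟨ ∑∑[≤]-truncate (λ i y → #nsLists (i + y) (suc j) b) (≤-trans b≤n∸1 (m∸n≤m n 1)) ⟩
  ∑[ i < b ] ∑[ y < b ] [ i ≤ y ] * #nsLists (i + y) (suc j) b
    ≡⟨ #nsLists-twoPlus (suc j) b ⟨
  #nsLists 0 (3 + j) b
    ∎
  where
  open ≡-Reasoning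
  b : ℕ
  b = suc n ∸ 3 * 2 ^ j
  b≤n∸1 : b ≤ n ∸ 1
  b≤n∸1 = ∸-monoʳ-≤ (suc n) (≤-trans (n≤1+n 2) (m≤m*n 3 (2 ^ j) {{m^n≢0 2 j}}))

theorem7 : ((n : ℕ) → f n 0 ≡ 1)
           × ((n k : ℕ) → 1 ≤ n → 1 ≤ k →
                (n < γ k → f n k ≡ 0)
                × (γ k ≤ n →
                     f n k ≡ sumFromTo 0 ((k ∸ 1) ⊓ (n ∸ γ k)) (λ p →
                               sumFromTo p (n ∸ γ k) (λ m →
                                 (n ∸ γ k + 1 ∸ m) * a m p))))
theorem7 = f-zero , λ where
  n zero    _ ()
  n (suc j) _ _ →
      (λ n<γ → trans (f≡#nsLists n j) (cong (#nsLists 0 (suc j)) (m≤n⇒m∸n≡0 n<γ)))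
    , (λ γ≤n → trans (f≡#nsLists n j) (trans (cong (#nsLists 0 (suc j)) (+-∸-assoc 1 γ≤n))
                                             (sym (∑∑a≡#nsLists j (n ∸ γ (suc j))))))
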